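{- Let $k \ge 2$ be an integer. Every graph $G$ satisfies $\beta^i(G) \ge \beta^k(G)$ for each $i \in \{1,2,\dots,k\}$.
   Context: All graphs are finite and simple. For a positive integer $j$ and $S\subseteq V(G)$, $\Lambda^j_G(S)$ is the set of vertices with at least $j$ neighbors in $S$, and $\beta^j(G)=\min\{|\Lambda^j_G(S)|/|S| : S\subseteq V(G),\ |S|\ge j,\ \Lambda^j_G(S)\ne V(G)\}$, with $\beta^j(G)=0$ if $|V(G)|<j$. -}

module Defs where

open import Data.Bool using (Bool; true; false; if_then_else_; not; _∧_)
open import Data.Nat using (ℕ; zero; suc; _<ᵇ_; _≤ᵇ_)
open import Data.Fin using (Fin)
open import Data.Fin.Subset using (Subset; ⊤; _∩_; ∣_∣)
open import Data.Vec using (Vec; []; _∷_; tabulate)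
open import Data.Vec.Properties using (≡-dec)
open import Data.Bool.Properties using () renaming (_≟_ to _≟B_)
open import Data.List using (List; []; _∷_; map; _++_; filter)
open import Data.Maybe using (Maybe; just; nothing)
open import Data.Integer using (+_)
open import Data.Rational using (ℚ; _/_; _⊓_; 0ℚ)
open import Relation.Nullary.Decidable using (does)
open import Relation.Binary.PropositionalEquality using (_≡_)

record Graph (n : ℕ) : Set where
  field
    adj   : Fin n → Fin n → Bool
    sym   : ∀ u v → adj u v ≡ adj v u
    irrefl : ∀ v → adj v v ≡ false

open Graph public

nbhd : ∀ {n} → Graph n → Fin n → Subset n
nbhd G v = tabulate (adj G v)

Λ : ∀ {n} → ℕ → Graph n → Subset n → Subset n
Λ j G S = tabulate (λ v → j ≤ᵇ ∣ S ∩ nbhd G v ∣)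

allSubsets : ∀ n → List (Subset n)
allSubsets zero = [] ∷ []
allSubsets (suc n) = map (true ∷_) (allSubsets n) ++ map (false ∷_) (allSubsets n)

-- a / b as a rational (only used with b ≥ 1; b = 0 gives 0)
ratio : ℕ → ℕ → ℚ
ratio a zero = 0ℚ
ratio a (suc b) = (+ a) / suc b

minimumℚ : List ℚ → Maybe ℚ
minimumℚ [] = nothing
minimumℚ (x ∷ xs) with minimumℚ xs
... | nothing = just x
... | just m = just (x ⊓ m)

admissible : ∀ {n} → ℕ → Graph n → Subset n → Bool
admissible j G S = (j ≤ᵇ ∣ S ∣) ∧ not (does (≡-dec _≟B_ (Λ j G S) ⊤))

-- β^j(G) = min { |Λ^j_G(S)| / |S| : S admissible }, and 0 if |V(G)| < j.
-- (When |V(G)| ≥ j ≥ 1 the admissible family is nonempty: any S with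
-- |S| = j has Λ^j_G(S) ∩ S = ∅, so the fallback 0 is never used then.)
β : ∀ {n} → ℕ → Graph n → ℚ
β {n} j G with n <ᵇ j
... | true = 0ℚ
... | false with minimumℚ (map (λ S → ratio ∣ Λ j G S ∣ ∣ S ∣) (filter (λ S → admissible j G S ≟B true) (allSubsets n)))
...   | just m = m
...   | nothing = 0ℚ

{-# OPTIONS --safe #-}
-- If |V(G)| < k then β^k(G) = 0.  Otherwise let S attain β^i(G).  If |S| ≥ k
-- then Λ^k(S) ⊆ Λ^i(S).  If |S| < k, enlarge S to a k-set T: a vertex with k
-- neighbours in T is adjacent to all of T, hence has |S| ≥ i neighbours in S,
-- so again Λ^k(T) ⊆ Λ^i(S).  Thus T is k-admissible and
-- |Λ^k(T)|/|T| ≤ |Λ^i(S)|/|S| = β^i(G).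
module Submission where

open import Defs
open import Data.Bool using (Bool; true; false)
open import Data.Bool.Properties using (T-≡) renaming (_≟_ to _≟B_)
open import Data.Nat using (ℕ; zero; suc; _≤_; _<_; _<ᵇ_; _≤ᵇ_; s≤s; _≤?_)
open import Data.Nat.Properties as ℕ using (≤ᵇ⇒≤; ≤⇒≤ᵇ; <⇒<ᵇ; <ᵇ⇒<)
open import Data.Integer as ℤ using (+_; +≤+)
import Data.Integer.Properties as ℤ
open import Data.Rational using (ℚ; 0ℚ; _⊓_; fromℚᵘ) renaming (_≤_ to _≤ℚ_)
open import Data.Rational.Properties as ℚ using (toℚᵘ-cancel-≤; toℚᵘ-fromℚᵘ)
open import Data.Rational.Unnormalised as ℚᵘ using (mkℚᵘ; *≤*) renaming (_≤_ to _≤ᵘ_)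
import Data.Rational.Unnormalised.Properties as ℚᵘ
open import Data.Fin using (Fin; zero)
open import Data.Fin.Subset using (Subset; ⊤; _∩_; ∣_∣; _∈_; _∉_; _⊆_; _⊂_; ⁅_⁆; Nonempty)
open import Data.Fin.Subset.Properties
  using (_∈?_; p⊂q⇒∣p∣<∣q∣; p⊆q⇒∣p∣≤∣q∣; p∩q⊆p; x∈p∩q⁺; x∈p∩q⁻; ∈⊤; ⊆⊤; ⊆-antisym;
         ∣p∣≤n; ∣⊤∣≡n; ∣⁅x⁆∣≡1; x∈⁅x⁆; s⊆s)
open import Data.Vec using ([]; _∷_; tabulate)
open import Data.Vec.Properties using (≡-dec; lookup∘tabulate; []=⇒lookup; lookup⇒[]=)
open import Data.List using (List; []; _∷_; map; filter)
open import Data.List.Membership.Propositional using () renaming (_∈_ to _∈ₗ_)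
open import Data.List.Membership.Propositional.Properties
  using (∈-map⁺; ∈-++⁺ˡ; ∈-++⁺ʳ; ∈-map∘filter⁺; ∈-map∘filter⁻)
open import Data.List.Relation.Unary.Any using (here; there)
open import Data.Maybe using (just; nothing; fromMaybe)
open import Data.Product using (∃; _×_; _,_; proj₂)
open import Data.Sum using (inj₁; inj₂)
open import Function using (_∘_; id)
open import Function.Bundles using (Equivalence)
open import Relation.Nullary using (yes; no; contradiction)
open import Relation.Nullary.Decidable using (dec-false)
open import Relation.Binary.PropositionalEquality as ≡
  using (_≡_; _≢_; refl; trans; cong; subst; subst₂)
open ℚ.≤-Reasoning

minimumℚ-just : ∀ {x} xs → x ∈ₗ xs → ∃ λ m → minimumℚ xs ≡ just m
minimumℚ-just (x ∷ xs) _ with minimumℚ xs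
... | nothing = x , refl
... | just m  = x ⊓ m , refl

minimumℚ-∈ : ∀ xs {m} → minimumℚ xs ≡ just m → m ∈ₗ xs
minimumℚ-∈ (x ∷ xs) eq with minimumℚ xs in min≡
minimumℚ-∈ (x ∷ xs) refl | nothing = here refl
minimumℚ-∈ (x ∷ xs) refl | just m with ℚ.⊓-sel x m
... | inj₁ x⊓m≡x = here x⊓m≡x
... | inj₂ x⊓m≡m = there (subst (_∈ₗ xs) (≡.sym x⊓m≡m) (minimumℚ-∈ xs min≡))

minimumℚ-≤ : ∀ xs {m x} → minimumℚ xs ≡ just m → x ∈ₗ xs → m ≤ℚ x
minimumℚ-≤ (x ∷ xs) eq x∈ with minimumℚ xs in min≡
minimumℚ-≤ (x ∷ xs) refl (here refl) | nothing = ℚ.≤-refl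
minimumℚ-≤ (x ∷ xs) refl (there y∈) | nothing with _ , min≡m ← minimumℚ-just xs y∈
  with () ← trans (≡.sym min≡) min≡m
minimumℚ-≤ (x ∷ xs) refl (here refl) | just m = ℚ.p⊓q≤p x m
minimumℚ-≤ (x ∷ xs) refl (there y∈) | just m = ℚ.≤-trans (ℚ.p⊓q≤q x m) (minimumℚ-≤ xs min≡ y∈)

fromℚᵘ-mono-≤ : ∀ {p q} → p ≤ᵘ q → fromℚᵘ p ≤ℚ fromℚᵘ q
fromℚᵘ-mono-≤ {p} {q} p≤q = toℚᵘ-cancel-≤
  (ℚᵘ.≤-respˡ-≃ (ℚᵘ.≃-sym (toℚᵘ-fromℚᵘ p)) (ℚᵘ.≤-respʳ-≃ (ℚᵘ.≃-sym (toℚᵘ-fromℚᵘ q)) p≤q))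

ratio-nonneg : ∀ a b → 0ℚ ≤ℚ ratio a b
ratio-nonneg a zero    = ℚ.≤-refl
ratio-nonneg a (suc b) = ℚ.nonNegative⁻¹ _ {{ℚ.normalize-nonNeg a (suc b)}}

ratio-mono : ∀ {a b c d} → a ≤ c → 1 ≤ d → d ≤ b → ratio a b ≤ℚ ratio c d
ratio-mono {a} {suc b} {c} {suc d} a≤c _ (s≤s d≤b) =
  fromℚᵘ-mono-≤ {mkℚᵘ (+ a) b} {mkℚᵘ (+ c) d} (*≤* a*d≤c*b)
  where
  a*d≤c*b : + a ℤ.* + suc d ℤ.≤ + c ℤ.* + suc b
  a*d≤c*b = subst₂ ℤ._≤_ (ℤ.pos-* a (suc d)) (ℤ.pos-* c (suc b))
              (+≤+ (ℕ.*-mono-≤ a≤c (s≤s d≤b)))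

∣p∣≤∣p∩q∣⇒p⊆q : ∀ {n} (p q : Subset n) → ∣ p ∣ ≤ ∣ p ∩ q ∣ → p ⊆ q
∣p∣≤∣p∩q∣⇒p⊆q p q ∣p∣≤∣p∩q∣ {x} x∈p with x ∈? q
... | yes x∈q = x∈q
... | no  x∉q = contradiction ∣p∣≤∣p∩q∣ (ℕ.<⇒≱ (p⊂q⇒∣p∣<∣q∣ p∩q⊂p))
  where
  p∩q⊂p : p ∩ q ⊂ p
  p∩q⊂p = p∩q⊆p p q , x , x∈p , λ x∈p∩q → x∉q (proj₂ (x∈p∩q⁻ p q x∈p∩q))

p⊆q⇒q≢⊤⇒p≢⊤ : ∀ {n} {p q : Subset n} → p ⊆ q → q ≢ ⊤ → p ≢ ⊤
p⊆q⇒q≢⊤⇒p≢⊤ p⊆q q≢⊤ refl = q≢⊤ (⊆-antisym ⊆⊤ (λ _ → p⊆q ∈⊤))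

⊆-extend : ∀ {n} (p : Subset n) {k} → ∣ p ∣ ≤ k → k ≤ n → ∃ λ q → p ⊆ q × ∣ q ∣ ≡ k
⊆-extend [] {zero} _ _ = [] , id , refl
⊆-extend (true ∷ p) {suc k} (s≤s ∣p∣≤k) (s≤s k≤n)
  with q , p⊆q , ∣q∣≡k ← ⊆-extend p ∣p∣≤k k≤n = true ∷ q , s⊆s p⊆q , cong suc ∣q∣≡k
⊆-extend {suc n} (false ∷ p) {k} ∣p∣≤k k≤1+n with k ≤? n
... | yes k≤n with q , p⊆q , ∣q∣≡k ← ⊆-extend p ∣p∣≤k k≤n = false ∷ q , s⊆s p⊆q , ∣q∣≡k
... | no  k≰n = ⊤ , ⊆⊤ , trans (∣⊤∣≡n (suc n)) (ℕ.≤-antisym (ℕ.≰⇒> k≰n) k≤1+n)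

∈-tabulate⁺ : ∀ {n} {f : Fin n → Bool} {x} → f x ≡ true → x ∈ tabulate f
∈-tabulate⁺ {f = f} {x} fx≡true =
  lookup⇒[]= x (tabulate f) (trans (lookup∘tabulate f x) fx≡true)

∈-tabulate⁻ : ∀ {n} {f : Fin n → Bool} {x} → x ∈ tabulate f → f x ≡ true
∈-tabulate⁻ {f = f} {x} x∈ = trans (≡.sym (lookup∘tabulate f x)) ([]=⇒lookup x∈)

record Admissible {n} (j : ℕ) (G : Graph n) (S : Subset n) : Set where
  constructor mkAdmissible
  field
    j≤∣S∣ : j ≤ ∣ S ∣
    Λ≢⊤   : Λ j G S ≢ ⊤

expansion : ∀ {n} → ℕ → Graph n → Subset n → ℚ
expansion j G S = ratio ∣ Λ j G S ∣ ∣ S ∣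

expansions : ∀ {n} → ℕ → Graph n → List ℚ
expansions {n} j G = map (expansion j G) (filter (λ S → admissible j G S ≟B true) (allSubsets n))

∈-allSubsets : ∀ {n} (S : Subset n) → S ∈ₗ allSubsets n
∈-allSubsets []                  = here refl
∈-allSubsets (true ∷ S)          = ∈-++⁺ˡ (∈-map⁺ (true ∷_) (∈-allSubsets S))
∈-allSubsets {suc n} (false ∷ S) =
  ∈-++⁺ʳ (map (true ∷_) (allSubsets n)) (∈-map⁺ (false ∷_) (∈-allSubsets S))

module _ {n} (G : Graph n) where

  x∉nbhd[x] : ∀ x → x ∉ nbhd G x
  x∉nbhd[x] x x∈N with () ← trans (≡.sym (∈-tabulate⁻ x∈N)) (irrefl G x)

  ∈Λ⁺ : ∀ {j} S {x} → j ≤ ∣ S ∩ nbhd G x ∣ → x ∈ Λ j G S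
  ∈Λ⁺ _ = ∈-tabulate⁺ ∘ Equivalence.to T-≡ ∘ ≤⇒≤ᵇ

  ∈Λ⁻ : ∀ {j} S {x} → x ∈ Λ j G S → j ≤ ∣ S ∩ nbhd G x ∣
  ∈Λ⁻ {j} S = ≤ᵇ⇒≤ j _ ∘ Equivalence.from T-≡ ∘ ∈-tabulate⁻

  Λ-antitone : ∀ {i k} S → i ≤ k → Λ k G S ⊆ Λ i G S
  Λ-antitone S i≤k = ∈Λ⁺ S ∘ ℕ.≤-trans i≤k ∘ ∈Λ⁻ S

  ∈Λ⇒⊆nbhd : ∀ {j} S {x} → ∣ S ∣ ≤ j → x ∈ Λ j G S → S ⊆ nbhd G x
  ∈Λ⇒⊆nbhd S {x} ∣S∣≤j x∈Λ =
    ∣p∣≤∣p∩q∣⇒p⊆q S (nbhd G x) (ℕ.≤-trans ∣S∣≤j (∈Λ⁻ S x∈Λ))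

  Nonempty⇒Λ≢⊤ : ∀ {j} S → Nonempty S → ∣ S ∣ ≤ j → Λ j G S ≢ ⊤
  Nonempty⇒Λ≢⊤ S (x , x∈S) ∣S∣≤j Λ≡⊤ =
    x∉nbhd[x] x (∈Λ⇒⊆nbhd S ∣S∣≤j (subst (x ∈_) (≡.sym Λ≡⊤) ∈⊤) x∈S)

  small-superset⇒Λ⊆Λ : ∀ {i k} S T → S ⊆ T → ∣ T ∣ ≤ k → i ≤ ∣ S ∣ → Λ k G T ⊆ Λ i G S
  small-superset⇒Λ⊆Λ S T S⊆T ∣T∣≤k i≤∣S∣ {x} x∈Λ =
    ∈Λ⁺ S (ℕ.≤-trans i≤∣S∣ (p⊆q⇒∣p∣≤∣q∣ S⊆S∩N))
    where
    S⊆S∩N : S ⊆ S ∩ nbhd G x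
    S⊆S∩N = λ y∈S → x∈p∩q⁺ (y∈S , ∈Λ⇒⊆nbhd T ∣T∣≤k x∈Λ (S⊆T y∈S))

  Λ-shrinking-superset : ∀ {i k} S → i ≤ k → k ≤ n → i ≤ ∣ S ∣ →
                         ∃ λ T → S ⊆ T × k ≤ ∣ T ∣ × Λ k G T ⊆ Λ i G S
  Λ-shrinking-superset {k = k} S i≤k k≤n i≤∣S∣ with k ≤? ∣ S ∣
  ... | yes k≤∣S∣ = S , id , k≤∣S∣ , Λ-antitone S i≤k
  ... | no  k≰∣S∣ with T , S⊆T , ∣T∣≡k ← ⊆-extend S (ℕ.<⇒≤ (ℕ.≰⇒> k≰∣S∣)) k≤n =
    T , S⊆T , ℕ.≤-reflexive (≡.sym ∣T∣≡k) ,
    small-superset⇒Λ⊆Λ S T S⊆T (ℕ.≤-reflexive ∣T∣≡k) i≤∣S∣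

  Admissible⇒admissible : ∀ {j S} → Admissible j G S → admissible j G S ≡ true
  Admissible⇒admissible {j} {S} (mkAdmissible j≤∣S∣ Λ≢⊤)
    rewrite Equivalence.to T-≡ (≤⇒≤ᵇ j≤∣S∣) | dec-false (≡-dec _≟B_ (Λ j G S) ⊤) Λ≢⊤ = refl

  admissible⇒Admissible : ∀ {j S} → admissible j G S ≡ true → Admissible j G S
  admissible⇒Admissible {j} {S} _ with j ≤ᵇ ∣ S ∣ in j≤ᵇ∣S∣ | ≡-dec _≟B_ (Λ j G S) ⊤
  ... | true | no Λ≢⊤ = mkAdmissible (≤ᵇ⇒≤ j ∣ S ∣ (Equivalence.from T-≡ j≤ᵇ∣S∣)) Λ≢⊤

  ∈-expansions⁺ : ∀ {j S} → Admissible j G S → expansion j G S ∈ₗ expansions j G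
  ∈-expansions⁺ {j} {S} adm =
    ∈-map∘filter⁺ (expansion j G) (λ S → admissible j G S ≟B true)
      (S , ∈-allSubsets S , refl , Admissible⇒admissible adm)

  ∈-expansions⁻ : ∀ {j r} → r ∈ₗ expansions j G → ∃ λ S → Admissible j G S × r ≡ expansion j G S
  ∈-expansions⁻ {j} r∈
    with S , _ , r≡ , adm ← ∈-map∘filter⁻ (expansion j G) (λ S → admissible j G S ≟B true)
                                          {xs = allSubsets n} r∈ =
    S , admissible⇒Admissible adm , r≡

  ∃-admissible : ∀ {j} → 1 ≤ j → j ≤ n → ∃ (Admissible j G)
  ∃-admissible {j} 1≤j j≤n@(s≤s _)
    with S , ⁅0⁆⊆S , ∣S∣≡j ←
           ⊆-extend ⁅ zero ⁆ (ℕ.≤-trans (ℕ.≤-reflexive (∣⁅x⁆∣≡1 {n = n} zero)) 1≤j) j≤n =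
    S , mkAdmissible (ℕ.≤-reflexive (≡.sym ∣S∣≡j))
          (Nonempty⇒Λ≢⊤ S (zero , ⁅0⁆⊆S (x∈⁅x⁆ zero)) (ℕ.≤-reflexive ∣S∣≡j))

  β-small : ∀ {j} → n < j → β j G ≡ 0ℚ
  β-small {j} n<j with n <ᵇ j | <⇒<ᵇ n<j
  ... | true | _ = refl

  β-large : ∀ {j} → j ≤ n → β j G ≡ fromMaybe 0ℚ (minimumℚ (expansions j G))
  β-large {j} j≤n with n <ᵇ j in n<ᵇj
  ... | true = contradiction (<ᵇ⇒< n j (Equivalence.from T-≡ n<ᵇj)) (ℕ.≤⇒≯ j≤n)
  ... | false with minimumℚ (expansions j G)
  ...   | just m  = refl
  ...   | nothing = refl

  β≤expansion : ∀ {j S} → Admissible j G S → β j G ≤ℚ expansion j G S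
  β≤expansion {j} {S} adm@(mkAdmissible j≤∣S∣ _)
    with m , min≡m ← minimumℚ-just (expansions j G) (∈-expansions⁺ adm) = begin
    β j G                                    ≡⟨ β-large (ℕ.≤-trans j≤∣S∣ (∣p∣≤n S)) ⟩
    fromMaybe 0ℚ (minimumℚ (expansions j G)) ≡⟨ cong (fromMaybe 0ℚ) min≡m ⟩
    m                                        ≤⟨ minimumℚ-≤ _ min≡m (∈-expansions⁺ adm) ⟩
    expansion j G S                          ∎

  β-attained : ∀ {j} → 1 ≤ j → j ≤ n → ∃ λ S → Admissible j G S × β j G ≡ expansion j G S
  β-attained {j} 1≤j j≤n
    with S₀ , S₀-adm ← ∃-admissible 1≤j j≤n
    with m , min≡m ← minimumℚ-just (expansions j G) (∈-expansions⁺ S₀-adm)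
    with S , S-adm , m≡ ← ∈-expansions⁻ (minimumℚ-∈ (expansions j G) min≡m) =
    S , S-adm , trans (β-large j≤n) (trans (cong (fromMaybe 0ℚ) min≡m) m≡)

  β-nonneg : ∀ {j} → 1 ≤ j → 0ℚ ≤ℚ β j G
  β-nonneg {j} 1≤j with j ≤? n
  ... | yes j≤n with S , _ , β≡ ← β-attained 1≤j j≤n =
    subst (0ℚ ≤ℚ_) (≡.sym β≡) (ratio-nonneg ∣ Λ j G S ∣ ∣ S ∣)
  ... | no  j≰n = ℚ.≤-reflexive (≡.sym (β-small (ℕ.≰⇒> j≰n)))

  admissible-lift : ∀ {i k S} → 1 ≤ i → i ≤ k → k ≤ n → Admissible i G S →
                    ∃ λ T → Admissible k G T × expansion k G T ≤ℚ expansion i G S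
  admissible-lift {S = S} 1≤i i≤k k≤n (mkAdmissible i≤∣S∣ Λ≢⊤)
    with T , S⊆T , k≤∣T∣ , Λ⊆Λ ← Λ-shrinking-superset S i≤k k≤n i≤∣S∣ =
    T , mkAdmissible k≤∣T∣ (p⊆q⇒q≢⊤⇒p≢⊤ Λ⊆Λ Λ≢⊤) ,
    ratio-mono (p⊆q⇒∣p∣≤∣q∣ Λ⊆Λ) (ℕ.≤-trans 1≤i i≤∣S∣) (p⊆q⇒∣p∣≤∣q∣ S⊆T)

-- The argument works for every k ≥ 1.
mainTheorem6 : (k : ℕ) → 2 ≤ k → {n : ℕ} → (G : Graph n) →
    (i : ℕ) → 1 ≤ i → i ≤ k → β k G ≤ℚ β i G
mainTheorem6 k _ {n} G i 1≤i i≤k with k ≤? n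
... | no k≰n = begin
  β k G ≡⟨ β-small G (ℕ.≰⇒> k≰n) ⟩
  0ℚ    ≤⟨ β-nonneg G 1≤i ⟩
  β i G ∎
... | yes k≤n
  with S , S-adm , βi≡ ← β-attained G 1≤i (ℕ.≤-trans i≤k k≤n)
  with T , T-adm , T≤S ← admissible-lift G 1≤i i≤k k≤n S-adm = begin
  β k G             ≤⟨ β≤expansion G T-adm ⟩
  expansion k G T   ≤⟨ T≤S ⟩
  expansion i G S   ≡⟨ ≡.sym βi≡ ⟩
  β i G             ∎
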